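{- Let $\gamma$ be a real number with $0<\gamma<\frac{1}{2}$ and let $G$ be a graph with $n$ vertices and minimum degree at least $(1-\gamma)n$. Suppose $x,y,z$ are pairwise adjacent vertices of $G$ with $t_{xy} \leqslant t_{xz} \leqslant t_{yz}$. Then (i) $\frac{1}{t_{yz}} \geqslant \frac{1-2\gamma}{2-2\gamma}\left(\frac{1}{t_{xy}}+\frac{1}{t_{xz}}\right)$, and (ii) $\frac{1}{t_{xy}} \leqslant \frac{1-\gamma}{2-4\gamma}\left(\frac{1}{t_{xz}}+\frac{1}{t_{yz}}\right)$.
   Context: For an edge $uv$ of a graph $G$, $t_{uv}$ denotes the number of vertices in $V(G)\setminus\{u,v\}$ adjacent to both $u$ and $v$.
   Formalization: The parameter γ ranges over the rationals rather than the real numbers. -}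

module Defs where

open import Data.Nat using (ℕ; zero; suc)
open import Data.Bool using (Bool; true; false; _∧_; not)
open import Data.Fin using (Fin; _≟_)
open import Data.List using (List; length; filterᵇ; allFin)
open import Data.Integer using (+_)
open import Data.Rational using (ℚ; _/_; 0ℚ)
open import Relation.Nullary using (does)
open import Relation.Binary.PropositionalEquality using (_≡_)

record Graph (n : ℕ) : Set where
  field
    adj    : Fin n → Fin n → Bool
    sym    : ∀ i j → adj i j ≡ adj j i
    irrefl : ∀ i → adj i i ≡ false
open Graph public

countFin : {n : ℕ} → (Fin n → Bool) → ℕ
countFin {n} p = length (filterᵇ p (allFin n))

deg : {n : ℕ} → Graph n → Fin n → ℕ
deg G v = countFin (adj G v)

t : {n : ℕ} → Graph n → Fin n → Fin n → ℕ
t G u v = countFin (λ w → adj G u w ∧ adj G v w ∧ not (does (w ≟ u)) ∧ not (does (w ≟ v)))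

ℕ→ℚ : ℕ → ℚ
ℕ→ℚ k = + k / 1

-- reciprocal 1/k of a natural number (convention: 1/0 := 0; never used
-- in the theorem since all t-values there are positive)
inv : ℕ → ℚ
inv zero    = 0ℚ
inv (suc k) = + 1 / suc k

{-# OPTIONS --safe #-}

-- Every vertex has at most γn non-neighbours. From deg x + deg y ≤ t_xy + n we get
-- t_xy ≥ (1 − 2γ)n, and t_yz ≤ deg y ≤ t_xy + (n − deg x) ≤ t_xy + γn; together
-- (1 − 2γ) t_yz ≤ (1 − γ) t_xy for any three vertices. With t_xy ≤ t_xz ≤ t_yz this
-- gives (1 − 2γ) t ≤ (1 − γ) t′ for any two codegrees t, t′ of the triangle; dividing
-- by t t′ and adding two such bounds yields (i) and (ii).

module Submission where

open import Defs hiding (sym)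
open import Data.Bool using (Bool; true; false; T; _∧_; _∨_; not)
open import Data.Bool.Properties using (T-∧; T-≡)
open import Data.Fin using (Fin; _≟_)
open import Data.Integer as ℤ using (+_)
import Data.Integer.Properties as ℤ
open import Data.List using ([]; _∷_; length; filterᵇ; allFin)
open import Data.List.Properties using (length-filter; length-tabulate)
open import Data.List.Membership.Propositional.Properties using (∈-filter⁺; ∈-allFin; ∈-length)
open import Data.List.Relation.Binary.Sublist.Propositional using (⊆-refl)
open import Data.List.Relation.Binary.Sublist.Propositional.Properties using (filter⁺; length-mono-≤)
open import Data.Nat using (ℕ; suc)
import Data.Nat as ℕ
import Data.Nat.Properties as ℕ
open import Data.Nat.Coprimality as Coprimality using (1-coprimeTo)
open import Data.Product using (_×_; _,_; proj₁; uncurry)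
open import Data.Rational
  using (ℚ; mkℚ; _/_; _+_; _-_; -_; _*_; _≤_; _<_; *≤*; 0ℚ; 1ℚ; ½; NonNegative; nonNegative)
open import Data.Rational.Properties
  using ( normalize-coprime; normalize-nonNeg; /-cong; ≤-trans; <⇒≤; module ≤-Reasoning
        ; +-comm; +-identityˡ; *-comm; *-identityˡ; *-inverseˡ; *-distribˡ-+; *-distribʳ-+
        ; +-mono-≤; +-monoˡ-≤; +-monoʳ-≤; *-monoˡ-≤-nonNeg; *-monoʳ-≤-nonNeg; nonNeg*nonNeg⇒nonNeg)
open import Data.Rational.Solver using (module +-*-Solver)
open import Data.Unit using (tt)
open import Function using (_∘_; id)
open import Function.Bundles using (Equivalence)
open import Relation.Binary.PropositionalEquality
open import Relation.Nullary using (does; yes; no)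
open import Relation.Nullary.Decidable using (T?)

open Equivalence using (to; from)
open +-*-Solver using (Polynomial; solve; _:=_; _:+_; _:-_; _:*_; con)

module _ {A : Set} where

  length-filterᵇ-mono : {p q : A → Bool} → (∀ x → T (p x) → T (q x)) →
    ∀ xs → length (filterᵇ p xs) ℕ.≤ length (filterᵇ q xs)
  length-filterᵇ-mono {p} {q} p⇒q xs =
    length-mono-≤ (filter⁺ (T? ∘ p) (T? ∘ q) (λ { refl → p⇒q _ }) (⊆-refl {x = xs}))

  length-filterᵇ-∧-∨ : (p q : A → Bool) → ∀ xs →
    length (filterᵇ p xs) ℕ.+ length (filterᵇ q xs)
      ≡ length (filterᵇ (λ x → p x ∧ q x) xs) ℕ.+ length (filterᵇ (λ x → p x ∨ q x) xs)
  length-filterᵇ-∧-∨ p q []       = refl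
  length-filterᵇ-∧-∨ p q (x ∷ xs) with p x | q x | length-filterᵇ-∧-∨ p q xs
  ... | true  | true  | ih = cong suc (trans (ℕ.+-suc _ _) (trans (cong suc ih) (sym (ℕ.+-suc _ _))))
  ... | true  | false | ih = trans (cong suc ih) (sym (ℕ.+-suc _ _))
  ... | false | true  | ih = trans (ℕ.+-suc _ _) (trans (cong suc ih) (sym (ℕ.+-suc _ _)))
  ... | false | false | ih = ih

module _ {n : ℕ} (G : Graph n) where

  adj⇒≢ : ∀ {u w} → T (adj G u w) → T (not (does (w ≟ u)))
  adj⇒≢ {u} {w} u~w with w ≟ u
  ... | yes refl = subst T (irrefl G u) u~w
  ... | no _     = tt

  common-neighbour-counted : ∀ {u v w} → T (adj G u w) → T (adj G v w) →
    T (adj G u w ∧ adj G v w ∧ not (does (w ≟ u)) ∧ not (does (w ≟ v)))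
  common-neighbour-counted u~w v~w =
    from T-∧ (u~w , from T-∧ (v~w , from T-∧ (adj⇒≢ u~w , adj⇒≢ v~w)))

  common-neighbour⇒0<t : ∀ {u v w} → adj G u w ≡ true → adj G v w ≡ true → 0 ℕ.< t G u v
  common-neighbour⇒0<t {w = w} u~w v~w = ∈-length (∈-filter⁺ (T? ∘ _) (∈-allFin w)
    (common-neighbour-counted (from T-≡ u~w) (from T-≡ v~w)))

  t≤deg : ∀ u v → t G u v ℕ.≤ deg G u
  t≤deg u v = length-filterᵇ-mono (λ _ → proj₁ ∘ to T-∧) (allFin n)

  deg+deg≤t+n : ∀ u v → deg G u ℕ.+ deg G v ℕ.≤ t G u v ℕ.+ n
  deg+deg≤t+n u v = begin
    deg G u ℕ.+ deg G v
      ≡⟨ length-filterᵇ-∧-∨ (adj G u) (adj G v) (allFin n) ⟩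
    countFin (λ w → adj G u w ∧ adj G v w) ℕ.+ countFin (λ w → adj G u w ∨ adj G v w)
      ≤⟨ ℕ.+-mono-≤ (length-filterᵇ-mono (λ _ → uncurry common-neighbour-counted ∘ to T-∧) (allFin n))
                    (length-filter (T? ∘ _) (allFin n)) ⟩
    t G u v ℕ.+ length (allFin n)
      ≡⟨ cong (t G u v ℕ.+_) (length-tabulate id) ⟩
    t G u v ℕ.+ n ∎
    where open ℕ.≤-Reasoning

ℕ→ℚ≡mkℚ : ∀ k → ℕ→ℚ k ≡ mkℚ (+ k) 0 (Coprimality.sym (1-coprimeTo k))
ℕ→ℚ≡mkℚ k = normalize-coprime (Coprimality.sym (1-coprimeTo k))

ℕ→ℚ-homo-+ : ∀ m n → ℕ→ℚ (m ℕ.+ n) ≡ ℕ→ℚ m + ℕ→ℚ n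
ℕ→ℚ-homo-+ m n = begin
  + (m ℕ.+ n) / 1                        ≡⟨ /-cong (sym numerator) refl ⟩
  (+ m ℤ.* + 1 ℤ.+ + n ℤ.* + 1) / 1     ≡⟨ cong₂ _+_ (ℕ→ℚ≡mkℚ m) (ℕ→ℚ≡mkℚ n) ⟨
  ℕ→ℚ m + ℕ→ℚ n                          ∎
  where
  open ≡-Reasoning
  numerator : + m ℤ.* + 1 ℤ.+ + n ℤ.* + 1 ≡ + (m ℕ.+ n)
  numerator = trans (cong₂ ℤ._+_ (ℤ.*-identityʳ (+ m)) (ℤ.*-identityʳ (+ n))) (sym (ℤ.pos-+ m n))

ℕ→ℚ-mono-≤ : ∀ {m n} → m ℕ.≤ n → ℕ→ℚ m ≤ ℕ→ℚ n
ℕ→ℚ-mono-≤ {m} {n} m≤n = subst₂ _≤_ (sym (ℕ→ℚ≡mkℚ m)) (sym (ℕ→ℚ≡mkℚ n))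
  (*≤* (subst₂ ℤ._≤_ (sym (ℤ.*-identityʳ (+ m))) (sym (ℤ.*-identityʳ (+ n))) (ℤ.+≤+ m≤n)))

inv-nonNeg : ∀ k → NonNegative (inv k)
inv-nonNeg ℕ.zero  = _
inv-nonNeg (suc k) = normalize-nonNeg 1 (suc k)

inv-inverseˡ : ∀ k .{{_ : ℕ.NonZero k}} → inv k * ℕ→ℚ k ≡ 1ℚ
inv-inverseˡ (suc k) = trans
  (cong₂ _*_ (normalize-coprime (1-coprimeTo (suc k))) (ℕ→ℚ≡mkℚ (suc k)))
  (*-inverseˡ (mkℚ (+ suc k) 0 (Coprimality.sym (1-coprimeTo (suc k)))))

+-cancelʳ-≤ : ∀ r {p q} → p + r ≤ q + r → p ≤ q
+-cancelʳ-≤ r {p} {q} p+r≤q+r = begin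
  p          ≡⟨ solve 2 (λ p r → p := p :+ r :- r) refl p r ⟩
  p + r - r  ≤⟨ +-monoˡ-≤ (- r) p+r≤q+r ⟩
  q + r - r  ≡⟨ solve 2 (λ q r → q :+ r :- r := q) refl q r ⟩
  q          ∎
  where open ≤-Reasoning

p≤q⇒0≤q-p : ∀ {p q} → p ≤ q → 0ℚ ≤ q - p
p≤q⇒0≤q-p {p} {q} p≤q = +-cancelʳ-≤ p (begin
  0ℚ + p     ≡⟨ +-identityˡ p ⟩
  p          ≤⟨ p≤q ⟩
  q          ≡⟨ solve 2 (λ p q → q := q :- p :+ p) refl p q ⟩
  q - p + p  ∎)
  where open ≤-Reasoning

*-≤-reciprocal : ∀ {α β p q p⁻¹ q⁻¹} → p⁻¹ * p ≡ 1ℚ → q⁻¹ * q ≡ 1ℚ →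
  .{{_ : NonNegative p⁻¹}} .{{_ : NonNegative q⁻¹}} →
  α * p ≤ β * q → α * q⁻¹ ≤ β * p⁻¹
*-≤-reciprocal {α} {β} {p} {q} {p⁻¹} {q⁻¹} p⁻¹p≡1 q⁻¹q≡1 αp≤βq = begin
  α * q⁻¹              ≡⟨ rescale α p p⁻¹ q⁻¹ p⁻¹p≡1 ⟩
  α * p * (p⁻¹ * q⁻¹)  ≤⟨ *-monoʳ-≤-nonNeg (p⁻¹ * q⁻¹) {{nonNeg*nonNeg⇒nonNeg p⁻¹ q⁻¹}} αp≤βq ⟩
  β * q * (p⁻¹ * q⁻¹)  ≡⟨ cong (β * q *_) (*-comm p⁻¹ q⁻¹) ⟩
  β * q * (q⁻¹ * p⁻¹)  ≡⟨ rescale β q q⁻¹ p⁻¹ q⁻¹q≡1 ⟨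
  β * p⁻¹              ∎
  where
  open ≤-Reasoning
  rescale : ∀ x y y⁻¹ z → y⁻¹ * y ≡ 1ℚ → x * z ≡ x * y * (y⁻¹ * z)
  rescale x y y⁻¹ z y⁻¹y≡1 = begin-equality
    x * z              ≡⟨ cong (x *_) (*-identityˡ z) ⟨
    x * (1ℚ * z)       ≡⟨ cong (λ e → x * (e * z)) y⁻¹y≡1 ⟨
    x * (y⁻¹ * y * z)  ≡⟨ solve 4 (λ x y y⁻¹ z → x :* (y⁻¹ :* y :* z) := x :* y :* (y⁻¹ :* z))
                              refl x y y⁻¹ z ⟩
    x * y * (y⁻¹ * z)  ∎

inv-*-≤ : ∀ {α β} m k .{{_ : ℕ.NonZero m}} .{{_ : ℕ.NonZero k}} →
  α * ℕ→ℚ m ≤ β * ℕ→ℚ k → α * inv k ≤ β * inv m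
inv-*-≤ {α} {β} m k =
  *-≤-reciprocal {α} {β} {ℕ→ℚ m} {ℕ→ℚ k} {inv m} {inv k} (inv-inverseˡ m) (inv-inverseˡ k)
    {{inv-nonNeg m}} {{inv-nonNeg k}}

degree-bounds⇒codegree-ratio : ∀ {γ N dᵤ dᵥ a c} → 0ℚ ≤ γ → 0ℚ ≤ 1ℚ - (γ + γ) →
  (1ℚ - γ) * N ≤ dᵤ → (1ℚ - γ) * N ≤ dᵥ → dᵤ + dᵥ ≤ a + N → c ≤ dᵥ →
  (1ℚ - (γ + γ)) * c ≤ (1ℚ - γ) * a
degree-bounds⇒codegree-ratio {γ} {N} {dᵤ} {dᵥ} {a} {c} 0≤γ 0≤s dᵤ-min dᵥ-min dᵤ+dᵥ≤a+N c≤dᵥ =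
  begin
  s * c                ≤⟨ *-monoˡ-≤-nonNeg s c≤dᵥ ⟩
  s * dᵥ               ≤⟨ *-monoˡ-≤-nonNeg s dᵥ≤a+γN ⟩
  s * (a + γ * N)      ≡⟨ solve 3 (λ γ N a → S γ :* (a :+ γ :* N) := S γ :* a :+ γ :* (S γ :* N))
                              refl γ N a ⟩
  s * a + γ * (s * N)  ≤⟨ +-monoʳ-≤ (s * a) (*-monoˡ-≤-nonNeg γ sN≤a) ⟩
  s * a + γ * a        ≡⟨ solve 2 (λ γ a → S γ :* a :+ γ :* a := R γ :* a) refl γ a ⟩
  r * a                ∎
  where
  open ≤-Reasoning
  s r : ℚ
  s = 1ℚ - (γ + γ)
  r = 1ℚ - γ
  S R : ∀ {k} → Polynomial k → Polynomial k
  S γ = con 1ℚ :- (γ :+ γ)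
  R γ = con 1ℚ :- γ
  instance
    _ = nonNegative 0≤γ
    _ = nonNegative 0≤s
  dᵥ≤a+γN : dᵥ ≤ a + γ * N
  dᵥ≤a+γN = +-cancelʳ-≤ (r * N) (begin
    dᵥ + r * N         ≤⟨ +-monoʳ-≤ dᵥ dᵤ-min ⟩
    dᵥ + dᵤ            ≡⟨ +-comm dᵥ dᵤ ⟩
    dᵤ + dᵥ            ≤⟨ dᵤ+dᵥ≤a+N ⟩
    a + N              ≡⟨ solve 3 (λ γ N a → a :+ N := a :+ γ :* N :+ R γ :* N) refl γ N a ⟩
    a + γ * N + r * N  ∎)
  sN≤a : s * N ≤ a
  sN≤a = +-cancelʳ-≤ N (begin
    s * N + N          ≡⟨ solve 2 (λ γ N → S γ :* N :+ N := R γ :* N :+ R γ :* N) refl γ N ⟩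
    r * N + r * N      ≤⟨ +-mono-≤ dᵤ-min dᵥ-min ⟩
    dᵤ + dᵥ            ≤⟨ dᵤ+dᵥ≤a+N ⟩
    a + N              ∎)

codegree-ratio : ∀ {γ n} (G : Graph n) → 0ℚ ≤ γ → 0ℚ ≤ 1ℚ - (γ + γ) →
  (∀ v → (1ℚ - γ) * ℕ→ℚ n ≤ ℕ→ℚ (deg G v)) →
  ∀ x y z → (1ℚ - (γ + γ)) * ℕ→ℚ (t G y z) ≤ (1ℚ - γ) * ℕ→ℚ (t G x y)
codegree-ratio {n = n} G 0≤γ 0≤s min-deg x y z =
  degree-bounds⇒codegree-ratio 0≤γ 0≤s (min-deg x) (min-deg y) degrees (ℕ→ℚ-mono-≤ (t≤deg G y z))
  where
  degrees : ℕ→ℚ (deg G x) + ℕ→ℚ (deg G y) ≤ ℕ→ℚ (t G x y) + ℕ→ℚ n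
  degrees = subst₂ _≤_ (ℕ→ℚ-homo-+ (deg G x) (deg G y)) (ℕ→ℚ-homo-+ (t G x y) n)
    (ℕ→ℚ-mono-≤ (deg+deg≤t+n G x y))

reciprocal-bounds : ∀ γ {a b c : ℕ} → 0ℚ ≤ 1ℚ - (γ + γ) → 0ℚ ≤ 1ℚ - γ →
  0 ℕ.< a → a ℕ.≤ b → b ℕ.≤ c →
  (1ℚ - (γ + γ)) * ℕ→ℚ c ≤ (1ℚ - γ) * ℕ→ℚ a →
  ((1ℚ - (γ + γ)) * (inv a + inv b) ≤ (1ℚ + 1ℚ - (γ + γ)) * inv c)
  × ((1ℚ + 1ℚ - (γ + γ + γ + γ)) * inv a ≤ (1ℚ - γ) * (inv b + inv c))
reciprocal-bounds γ {a} {b} {c} 0≤s 0≤r 0<a a≤b b≤c sc≤ra = part-i , part-ii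
  where
  open ≤-Reasoning
  s r : ℚ
  s = 1ℚ - (γ + γ)
  r = 1ℚ - γ
  instance
    _ = nonNegative 0≤s
    _ = nonNegative 0≤r
    a≢0 = ℕ.>-nonZero 0<a
    b≢0 = ℕ.>-nonZero (ℕ.<-≤-trans 0<a a≤b)
    c≢0 = ℕ.>-nonZero (ℕ.<-≤-trans 0<a (ℕ.≤-trans a≤b b≤c))
  sc≤rb : s * ℕ→ℚ c ≤ r * ℕ→ℚ b
  sc≤rb = ≤-trans sc≤ra (*-monoˡ-≤-nonNeg r (ℕ→ℚ-mono-≤ a≤b))
  sb≤ra : s * ℕ→ℚ b ≤ r * ℕ→ℚ a
  sb≤ra = ≤-trans (*-monoˡ-≤-nonNeg s (ℕ→ℚ-mono-≤ b≤c)) sc≤ra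
  part-i : s * (inv a + inv b) ≤ (1ℚ + 1ℚ - (γ + γ)) * inv c
  part-i = begin
    s * (inv a + inv b)          ≡⟨ *-distribˡ-+ s (inv a) (inv b) ⟩
    s * inv a + s * inv b        ≤⟨ +-mono-≤ (inv-*-≤ {s} {r} c a sc≤ra) (inv-*-≤ {s} {r} c b sc≤rb) ⟩
    r * inv c + r * inv c        ≡⟨ *-distribʳ-+ (inv c) r r ⟨
    (r + r) * inv c              ≡⟨ cong (_* inv c) (solve 1 (λ γ →
                                      (con 1ℚ :- γ) :+ (con 1ℚ :- γ) := con 1ℚ :+ con 1ℚ :- (γ :+ γ))
                                      refl γ) ⟩
    (1ℚ + 1ℚ - (γ + γ)) * inv c  ∎
  part-ii : (1ℚ + 1ℚ - (γ + γ + γ + γ)) * inv a ≤ r * (inv b + inv c)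
  part-ii = begin
    (1ℚ + 1ℚ - (γ + γ + γ + γ)) * inv a  ≡⟨ cong (_* inv a) (solve 1 (λ γ →
                                              con 1ℚ :+ con 1ℚ :- (γ :+ γ :+ γ :+ γ)
                                                := (con 1ℚ :- (γ :+ γ)) :+ (con 1ℚ :- (γ :+ γ)))
                                              refl γ) ⟩
    (s + s) * inv a                      ≡⟨ *-distribʳ-+ (inv a) s s ⟩
    s * inv a + s * inv a                ≤⟨ +-mono-≤ (inv-*-≤ {s} {r} b a sb≤ra) (inv-*-≤ {s} {r} c a sc≤ra) ⟩
    r * inv b + r * inv c                ≡⟨ *-distribˡ-+ r (inv b) (inv c) ⟨
    r * (inv b + inv c)                  ∎

lemma3p5 : (γ : ℚ) → 0ℚ < γ → γ < ½ →
    (n : ℕ) (G : Graph n) →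
    (∀ v → (1ℚ - γ) * ℕ→ℚ n ≤ ℕ→ℚ (deg G v)) →
    (x y z : Fin n) →
    adj G x y ≡ true → adj G x z ≡ true → adj G y z ≡ true →
    Data.Nat._≤_ (t G x y) (t G x z) → Data.Nat._≤_ (t G x z) (t G y z) →
    ((1ℚ - (γ + γ)) * (inv (t G x y) + inv (t G x z)) ≤ (1ℚ + 1ℚ - (γ + γ)) * inv (t G y z))
    × ((1ℚ + 1ℚ - (γ + γ + γ + γ)) * inv (t G x y) ≤ (1ℚ - γ) * (inv (t G x z) + inv (t G y z)))
lemma3p5 γ 0<γ γ<½ n G min-deg x y z _ x~z y~z txy≤txz txz≤tyz =
  reciprocal-bounds γ 0≤s 0≤r (common-neighbour⇒0<t G x~z y~z) txy≤txz txz≤tyz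
    (codegree-ratio G 0≤γ 0≤s min-deg x y z)
  where
  0≤γ : 0ℚ ≤ γ
  0≤γ = <⇒≤ 0<γ
  -- γ + γ ≤ ½ + ½, and ½ + ½ computes to 1ℚ
  0≤s : 0ℚ ≤ 1ℚ - (γ + γ)
  0≤s = p≤q⇒0≤q-p (+-mono-≤ (<⇒≤ γ<½) (<⇒≤ γ<½))
  0≤r : 0ℚ ≤ 1ℚ - γ
  0≤r = subst (0ℚ ≤_) (solve 1 (λ γ → con 1ℚ :- (γ :+ γ) :+ γ := con 1ℚ :- γ) refl γ)
    (+-mono-≤ 0≤s 0≤γ)
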